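{- For every $r\ge 2$, the glued binary tree $GT(r)$ satisfies ${\rm gp}_{\rm t}(GT(r))={\rm gp}_{\rm d}(GT(r))=0$.
   Context: A perfect binary tree of depth $r$ is a rooted tree in which every non-leaf vertex has exactly 2 children and all leaves have depth $r$. $GT(r)$ is obtained from two copies of it by identifying each leaf of the first copy with the corresponding leaf (under the natural isomorphism) of the second copy. For $S\subseteq V(G)$, two vertices $u,v$ are $S$-positionable if every shortest $u,v$-path $P$ satisfies $V(P)\cap S\subseteq\{u,v\}$. $S$ is a general position set if every two vertices of $S$ are $S$-positionable; a dual general position set if moreover every two vertices of $V(G)\setminus S$ are $S$-positionable; a total general position set if every two vertices of $G$ are $S$-positionable. ${\rm gp}_{\rm d}(G)$ and ${\rm gp}_{\rm t}(G)$ are the maximum sizes of a dual, respectively total, general position set (the empty set counts, so these can be $0$). -}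

module Defs where

open import Data.Nat using (ℕ; zero; suc; _<_; _≤_)
open import Data.Bool using (Bool)
open import Data.Vec using (Vec; _∷_)
open import Data.List using (List; []; _∷_)
open import Data.List.Membership.Propositional using (_∈_)
open import Data.Sum using (_⊎_)
open import Data.Product using (_×_)
open import Relation.Binary.PropositionalEquality using (_≡_; subst)
open import Relation.Nullary using (¬_)

-- Simple undirected graphs (adjacency given as a relation; symmetry is
-- built in by the constructions below).

record Graph : Set₁ where
  field
    V   : Set
    Adj : V → V → Set

module _ (G : Graph) where
  open Graph G

  data Walk : V → V → ℕ → Set where
    []  : ∀ {u} → Walk u u 0
    _∷_ : ∀ {u w v n} → Adj u w → Walk w v n → Walk u v (suc n)

  verts : ∀ {u v n} → Walk u v n → List V
  verts {u} []      = u ∷ []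
  verts {u} (_ ∷ p) = u ∷ verts p

  -- A shortest u,v-path: a walk of length n such that no u,v-walk is
  -- shorter.  (Shortest walks are automatically paths.)
  IsShortest : ∀ {u v n} → Walk u v n → Set
  IsShortest {u} {v} {n} _ = ∀ m → Walk u v m → n ≤ m

  Positionable : (V → Set) → V → V → Set
  Positionable S u v =
    ∀ n (P : Walk u v n) → IsShortest P →
    ∀ x → x ∈ verts P → S x → (x ≡ u ⊎ x ≡ v)

  IsGP : (V → Set) → Set
  IsGP S = ∀ u v → S u → S v → Positionable S u v

  IsDualGP : (V → Set) → Set
  IsDualGP S = IsGP S × (∀ u v → ¬ S u → ¬ S v → Positionable S u v)

  IsTotalGP : (V → Set) → Set
  IsTotalGP S = ∀ u v → Positionable S u v

  GpDualZero : Set₁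
  GpDualZero = ∀ (S : V → Set) → IsDualGP S → ∀ x → ¬ S x

  GpTotalZero : Set₁
  GpTotalZero = ∀ (S : V → Set) → IsTotalGP S → ∀ x → ¬ S x

-- A vertex of the perfect binary tree of depth r is a binary word of
-- length k ≤ r (root = empty word, children of w are b ∷ w).  GT(r) has
-- two copies (indexed by a Bool "side") of the non-leaf vertices
-- (length k < r), and a single shared copy of the leaves (length r).

data GTV (r : ℕ) : Set where
  inner : (side : Bool) (k : ℕ) → k < r → Vec Bool k → GTV r
  leaf  : Vec Bool r → GTV r

data GTEdge (r : ℕ) : GTV r → GTV r → Set where
  toInner : ∀ s k (p : k < r) (q : suc k < r) (b : Bool) (w : Vec Bool k) →
            GTEdge r (inner s k p w) (inner s (suc k) q (b ∷ w))
  toLeaf  : ∀ s k (p : k < r) (e : suc k ≡ r) (b : Bool) (w : Vec Bool k) →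
            GTEdge r (inner s k p w) (leaf (subst (Vec Bool) e (b ∷ w)))

GT : ℕ → Graph
GT r = record
  { V   = GTV r
  ; Adj = λ x y → GTEdge r x y ⊎ GTEdge r y x
  }

{-# OPTIONS --safe #-}
-- If x ∈ S is the middle vertex of a geodesic u – x – v of length two, then u and v
-- are not S-positionable, so a dual general position set S contains exactly one of
-- u, v.  The parent and the two children of an internal vertex of GT(r) are pairwise
-- at distance two through it, and no set contains exactly one of each of three pairs
-- formed from three vertices; hence no internal vertex lies in S.  The roots and the
-- leaves have two neighbours at distance two from each other, and for r ≥ 2 these
-- neighbours are internal, so they lie outside S and again S cannot contain the
-- vertex.  Total general position sets are dual ones.
module Submission where

open import Defs
open import Data.Bool using (Bool; true; false)
open import Data.Empty using (⊥; ⊥-elim)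
open import Data.List.Relation.Unary.Any using (here; there)
open import Data.Nat using (ℕ; suc; _≤_; _<_; z≤n; s≤s)
open import Data.Nat.Properties using (suc-injective; 1+n≢n; m≢1+n+m; n<1+n; <⇒≤; m≤n⇒m<n∨m≡n)
open import Data.Product using (_×_; _,_; proj₂; ∃₂)
open import Data.Sum using (_⊎_; inj₁; inj₂)
open import Data.Vec using (Vec; []; _∷_)
open import Relation.Binary.PropositionalEquality using (_≡_; _≢_; refl; sym; trans; cong; subst)
open import Relation.Nullary using (¬_)

Opposite : Set → Set → Set
Opposite P Q = (P → Q → ⊥) × (¬ P → ¬ Q → ⊥)

¬Opposite-triangle : ∀ {P Q R : Set} → Opposite P Q → Opposite P R → Opposite Q R → ⊥
¬Opposite-triangle {P} {Q} (p∧q⇒⊥ , ¬p∧¬q⇒⊥) (p∧r⇒⊥ , ¬p∧¬r⇒⊥) (q∧r⇒⊥ , ¬q∧¬r⇒⊥) = ¬p∧¬q⇒⊥ ¬p ¬q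
  where
  ¬p : ¬ P
  ¬p p = ¬q∧¬r⇒⊥ (p∧q⇒⊥ p) (p∧r⇒⊥ p)
  ¬q : ¬ Q
  ¬q q = ¬p∧¬r⇒⊥ ¬p (q∧r⇒⊥ q)

module _ {G : Graph} where
  open Graph G

  record IsMidpoint (x u v : V) : Set where
    field
      adjˡ        : Adj u x
      adjʳ        : Adj x v
      distinct    : u ≢ v
      nonadjacent : ¬ Adj u v

  module _ {x u v : V} (mid : IsMidpoint x u v) where
    open IsMidpoint mid

    midpoint-path : Walk G u v 2
    midpoint-path = adjˡ ∷ adjʳ ∷ []

    midpoint-path-isShortest : IsShortest G midpoint-path
    midpoint-path-isShortest 0             []       = ⊥-elim (distinct refl)
    midpoint-path-isShortest 1             (a ∷ []) = ⊥-elim (nonadjacent a)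
    midpoint-path-isShortest (suc (suc _)) _        = s≤s (s≤s z≤n)

    midpoint-¬Positionable : ∀ {S : V → Set} → S x → ¬ Positionable G S u v
    midpoint-¬Positionable Sx pos with pos 2 midpoint-path midpoint-path-isShortest x (there (here refl)) Sx
    ... | inj₁ refl = nonadjacent adjʳ
    ... | inj₂ refl = nonadjacent adjˡ

  IsDualGP⇒midpoint-Opposite : ∀ {S : V → Set} {x u v} → IsDualGP G S →
                               IsMidpoint x u v → S x → Opposite (S u) (S v)
  IsDualGP⇒midpoint-Opposite (gp , co-gp) mid Sx =
    (λ Su Sv → midpoint-¬Positionable mid Sx (gp _ _ Su Sv)) ,
    (λ ¬Su ¬Sv → midpoint-¬Positionable mid Sx (co-gp _ _ ¬Su ¬Sv))

  IsDualGP-triple-midpoint-∉ : ∀ {S : V → Set} {x a b c} → IsDualGP G S →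
    IsMidpoint x a b → IsMidpoint x a c → IsMidpoint x b c → ¬ S x
  IsDualGP-triple-midpoint-∉ dual ab ac bc Sx = ¬Opposite-triangle
    (IsDualGP⇒midpoint-Opposite dual ab Sx)
    (IsDualGP⇒midpoint-Opposite dual ac Sx)
    (IsDualGP⇒midpoint-Opposite dual bc Sx)

  IsDualGP-midpoint-∉ : ∀ {S : V → Set} {x u v} → IsDualGP G S →
                        IsMidpoint x u v → ¬ S u → ¬ S v → ¬ S x
  IsDualGP-midpoint-∉ dual mid ¬Su ¬Sv Sx =
    proj₂ (IsDualGP⇒midpoint-Opposite dual mid Sx) ¬Su ¬Sv

  IsTotalGP⇒IsDualGP : ∀ {S : V → Set} → IsTotalGP G S → IsDualGP G S
  IsTotalGP⇒IsDualGP total = (λ u v _ _ → total u v) , (λ u v _ _ → total u v)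

module _ {r : ℕ} where
  private
    G : Graph
    G = GT r
  open Graph G using (Adj)

  depth : GTV r → ℕ
  depth (inner _ k _ _) = k
  depth (leaf _)        = r

  GTEdge-depth : ∀ {x y} → GTEdge r x y → depth y ≡ suc (depth x)
  GTEdge-depth (toInner _ _ _ _ _ _) = refl
  GTEdge-depth (toLeaf _ _ _ e _ _)  = sym e

  Adj-depth : ∀ {x y} → Adj x y → depth y ≡ suc (depth x) ⊎ depth x ≡ suc (depth y)
  Adj-depth (inj₁ e) = inj₁ (GTEdge-depth e)
  Adj-depth (inj₂ e) = inj₂ (GTEdge-depth e)

  same-depth⇒¬Adj : ∀ {x y} → depth x ≡ depth y → ¬ Adj x y
  same-depth⇒¬Adj dx≡dy a with Adj-depth a
  ... | inj₁ dy≡1+dx = 1+n≢n (trans (sym dy≡1+dx) (sym dx≡dy))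
  ... | inj₂ dx≡1+dy = 1+n≢n (trans (sym dx≡1+dy) dx≡dy)

  depth+2⇒¬Adj : ∀ {x y} → depth y ≡ suc (suc (depth x)) → ¬ Adj x y
  depth+2⇒¬Adj dy≡2+dx a with Adj-depth a
  ... | inj₁ dy≡1+dx = 1+n≢n (trans (sym dy≡2+dx) dy≡1+dx)
  ... | inj₂ dx≡1+dy = m≢1+n+m _ (subst (λ d → _ ≡ suc d) dy≡2+dx dx≡1+dy)

  siblings-midpoint : ∀ {x c₀ c₁} → GTEdge r x c₀ → GTEdge r x c₁ → c₀ ≢ c₁ →
                      IsMidpoint {G} x c₀ c₁
  siblings-midpoint e₀ e₁ c₀≢c₁ = record
    { adjˡ        = inj₂ e₀
    ; adjʳ        = inj₁ e₁
    ; distinct    = c₀≢c₁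
    ; nonadjacent = same-depth⇒¬Adj (trans (GTEdge-depth e₀) (sym (GTEdge-depth e₁)))
    }

  co-parents-midpoint : ∀ {x p₀ p₁} → GTEdge r p₀ x → GTEdge r p₁ x → p₀ ≢ p₁ →
                        IsMidpoint {G} x p₀ p₁
  co-parents-midpoint e₀ e₁ p₀≢p₁ = record
    { adjˡ        = inj₁ e₀
    ; adjʳ        = inj₂ e₁
    ; distinct    = p₀≢p₁
    ; nonadjacent = same-depth⇒¬Adj
                      (suc-injective (trans (sym (GTEdge-depth e₀)) (GTEdge-depth e₁)))
    }

  parent-child-midpoint : ∀ {p x c} → GTEdge r p x → GTEdge r x c → IsMidpoint {G} x p c
  parent-child-midpoint e₀ e₁ = record
    { adjˡ        = inj₁ e₀
    ; adjʳ        = inj₁ e₁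
    ; distinct    = λ p≡c → m≢1+n+m _ (trans (cong depth p≡c) depth+2)
    ; nonadjacent = depth+2⇒¬Adj depth+2
    }
    where
    depth+2 = trans (GTEdge-depth e₁) (cong suc (GTEdge-depth e₀))

  leaf-children-distinct : ∀ {k} (e : suc k ≡ r) (w : Vec Bool k) →
    leaf (subst (Vec Bool) e (true ∷ w)) ≢ leaf (subst (Vec Bool) e (false ∷ w))
  leaf-children-distinct refl w ()

  children : ∀ s k (p : k < r) w → ∃₂ λ c₀ c₁ →
             GTEdge r (inner s k p w) c₀ × GTEdge r (inner s k p w) c₁ × c₀ ≢ c₁
  children s k p w with m≤n⇒m<n∨m≡n p
  ... | inj₁ q = _ , _ , toInner s k p q true w , toInner s k p q false w , λ ()
  ... | inj₂ e = _ , _ , toLeaf s k p e true w , toLeaf s k p e false w , leaf-children-distinct e w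

  module _ {S : GTV r → Set} (dual : IsDualGP G S) where

    IsDualGP-internal-∉ : ∀ s k (p : suc k < r) w → ¬ S (inner s (suc k) p w)
    IsDualGP-internal-∉ s k p (b ∷ w) with children s (suc k) p (b ∷ w)
    ... | _ , _ , e₀ , e₁ , c₀≢c₁ = IsDualGP-triple-midpoint-∉ dual
      (parent-child-midpoint e e₀) (parent-child-midpoint e e₁) (siblings-midpoint e₀ e₁ c₀≢c₁)
      where
      e = toInner s k (<⇒≤ p) p b w

    IsDualGP-root-∉ : 2 ≤ r → ∀ s (p : 0 < r) → ¬ S (inner s 0 p [])
    IsDualGP-root-∉ 2≤r s p = IsDualGP-midpoint-∉ dual
      (siblings-midpoint (toInner s 0 p 2≤r true []) (toInner s 0 p 2≤r false []) (λ ()))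
      (IsDualGP-internal-∉ s 0 2≤r (true ∷ []))
      (IsDualGP-internal-∉ s 0 2≤r (false ∷ []))

    IsDualGP-leaf-∉ : 2 ≤ r → ∀ l → ¬ S (leaf l)
    IsDualGP-leaf-∉ (s≤s (s≤s z≤n)) (b ∷ w) = IsDualGP-midpoint-∉ dual
      (co-parents-midpoint (toLeaf true _ p refl b w) (toLeaf false _ p refl b w) (λ ()))
      (IsDualGP-internal-∉ true _ p w)
      (IsDualGP-internal-∉ false _ p w)
      where
      p = n<1+n _

  GT-gpDualZero : 2 ≤ r → GpDualZero G
  GT-gpDualZero 2≤r S dual (inner s 0 p [])      = IsDualGP-root-∉ dual 2≤r s p
  GT-gpDualZero 2≤r S dual (inner s (suc k) p w) = IsDualGP-internal-∉ dual s k p w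
  GT-gpDualZero 2≤r S dual (leaf l)              = IsDualGP-leaf-∉ dual 2≤r l

mainTheorem10 : ∀ (r : ℕ) → 2 ≤ r → GpTotalZero (GT r) × GpDualZero (GT r)
mainTheorem10 r 2≤r =
  (λ S total → GT-gpDualZero 2≤r S (IsTotalGP⇒IsDualGP total)) , GT-gpDualZero 2≤r
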